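{- Let $G$ be a finite simple graph with no isolated vertices and $n=|V(G)|$ vertices. Then every $G$-CFF$(t,n)$ $\{B_v: v\in V(G)\}$ is a $1$-CFF$(t,n)$, i.e. $B_u\not\subseteq B_v$ for all distinct vertices $u,v$.
   Context: For a finite simple graph $G$, a $G$-CFF$(t,|V(G)|)$ is a family of subsets $B_v\subseteq[1,t]=\{1,\dots,t\}$, one for each vertex $v$, such that for every edge $\{a,b\}$ of $G$: (i) $B_a\not\subseteq B_b$ and $B_b\not\subseteq B_a$, and (ii) for every vertex $w\notin\{a,b\}$, $B_w\not\subseteq B_a\cup B_b$. -}

module Defs where

open import Data.Nat using (ℕ)
open import Data.Fin using (Fin)
open import Data.Fin.Subset using (Subset; _⊆_; _∪_)
open import Data.Product using (Σ)
open import Relation.Nullary using (¬_)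
open import Relation.Binary.PropositionalEquality using (_≡_)

record SimpleGraph (n : ℕ) : Set₁ where
  field
    Adj     : Fin n → Fin n → Set
    symm    : ∀ {a b} → Adj a b → Adj b a
    irrefl  : ∀ {a} → ¬ Adj a a
open SimpleGraph public

NoIsolated : ∀ {n} → SimpleGraph n → Set
NoIsolated {n} G = (v : Fin n) → Σ (Fin n) (λ u → Adj G v u)

IsGCFF : ∀ {n} (t : ℕ) → SimpleGraph n → (Fin n → Subset t) → Set
IsGCFF {n} t G B =
  ∀ a b → Adj G a b →
    (¬ (B a ⊆ B b)) × (¬ (B b ⊆ B a)) ×
    ((w : Fin n) → ¬ (w ≡ a) → ¬ (w ≡ b) → ¬ (B w ⊆ (B a ∪ B b)))
  where open import Data.Product using (_×_)

Is1CFF : ∀ {n} (t : ℕ) → (Fin n → Subset t) → Set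
Is1CFF {n} t B = (u v : Fin n) → ¬ (u ≡ v) → ¬ (B u ⊆ B v)

module Submission where

open import Defs
open import Data.Nat using (ℕ)
open import Data.Fin using (Fin; _≟_)
open import Data.Fin.Subset using (Subset; _⊆_)
open import Data.Fin.Subset.Properties using (p⊆p∪q)
open import Data.Product using (_,_)
open import Relation.Nullary using (¬_; yes; no)
open import Relation.Binary.PropositionalEquality using (_≡_; refl; sym)

-- If u is the neighbour x, condition (i) applies; otherwise B u ⊆ B v ⊆ B v ∪ B x
-- violates condition (ii) for the edge {v, x}.
neighbour⇒not-covered : ∀ {n t} (G : SimpleGraph n) {B : Fin n → Subset t} →
  IsGCFF t G B → ∀ {v x} → Adj G v x → ∀ u → ¬ (u ≡ v) → ¬ (B u ⊆ B v)
neighbour⇒not-covered G {B} cff {v} {x} v~x u u≢v Bu⊆Bv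
  with cff v x v~x | x ≟ u
... | _ , x⊈v , _       | yes refl = x⊈v Bu⊆Bv
... | _ , _ , uncovered | no x≢u   =
  uncovered u u≢v (λ u≡x → x≢u (sym u≡x)) (λ i∈Bu → p⊆p∪q (B x) (Bu⊆Bv i∈Bu))

theorem4p9 : (n t : ℕ) (G : SimpleGraph n) → NoIsolated G →
    (B : Fin n → Subset t) → IsGCFF t G B → Is1CFF t B
theorem4p9 n t G noIsolated B cff u v u≢v with noIsolated v
... | _ , v~x = neighbour⇒not-covered G cff v~x u u≢v
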